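{- Let $D$ be a finite digraph without loops or two-cycles, and let $\overleftarrow{D}$ be its reverse. Then exactly one of the following holds: (i) there is a vertex-weighting $\eta: V(D)\to[0,\infty)$, not identically zero, such that every vertex $v$ of $D$ satisfies $\eta(N_1^+(v)) \le \eta(N_2^+(v))$ (computed in $D$); (ii) there is a vertex-weighting $\eta: V(D)\to[0,\infty)$ such that every vertex $v$ of $\overleftarrow{D}$ satisfies $\eta(N_1^+(v)) > \eta(N_2^+(v))$ (computed in $\overleftarrow{D}$).
   Context: For a digraph $D$ and vertices $u,v$, $u$ is an $n$th out-neighbor of $v$ if the shortest directed path from $v$ to $u$ has exactly $n$ arcs; $N_n^+(v)$ denotes the set of $n$th out-neighbors of $v$. A vertex-weighting is a function $\eta$ assigning each vertex a nonnegative real number, extended to sets by $\eta(S)=\sum_{x\in S}\eta(x)$. The reverse $\overleftarrow{D}$ has vertex set $V(D)$ and arc set $\{vu : uv \in A(D)\}$. A vertex with $\eta(N_1^+(v))\le\eta(N_2^+(v))$ is called weakly expanding; one with $\eta(N_1^+(v))>\eta(N_2^+(v))$ is called strongly contracting.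
   Formalization: The vertex-weightings η take values in the nonnegative rationals rather than in $[0,\infty)$. -}

module Defs where

open import Data.Nat using (ℕ; zero; suc)
open import Data.Fin using (Fin; _≟_)
open import Data.Bool using (Bool; true; false; _∧_; _∨_; not; if_then_else_)
open import Data.Rational using (ℚ; 0ℚ; _+_; _≤_; _<_)
open import Data.Product using (Σ; _×_)
open import Relation.Nullary using (¬_)
open import Relation.Nullary.Decidable using (⌊_⌋)
open import Relation.Binary.PropositionalEquality using (_≡_; _≢_)

-- A finite digraph on vertex set Fin n, given by its (decidable) arc relation:
-- arc u v ≡ true  iff  uv is an arc.
Digraph : ℕ → Set
Digraph n = Fin n → Fin n → Bool

Loopless : ∀ {n} → Digraph n → Set
Loopless {n} D = (v : Fin n) → D v v ≡ false

NoTwoCycles : ∀ {n} → Digraph n → Set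
NoTwoCycles {n} D = (u v : Fin n) → ¬ (D u v ≡ true × D v u ≡ true)

reverse : ∀ {n} → Digraph n → Digraph n
reverse D u v = D v u

anyFin : ∀ {n} → (Fin n → Bool) → Bool
anyFin {zero} f = false
anyFin {suc n} f = f Fin.zero ∨ anyFin (λ i → f (Fin.suc i))

sumFin : ∀ {n} → (Fin n → ℚ) → ℚ
sumFin {zero} f = 0ℚ
sumFin {suc n} f = f Fin.zero + sumFin (λ i → f (Fin.suc i))

walk : ∀ {n} → Digraph n → ℕ → Fin n → Fin n → Bool
walk D zero v u = ⌊ v ≟ u ⌋
walk D (suc k) v u = anyFin (λ w → walk D k v w ∧ D w u)

walkBelow : ∀ {n} → Digraph n → ℕ → Fin n → Fin n → Bool
walkBelow D zero v u = false
walkBelow D (suc k) v u = walk D k v u ∨ walkBelow D k v u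

-- u is a k-th out-neighbour of v: the shortest directed v→u path has exactly k arcs
-- (a shortest walk is a path, so this is the same as via walks)
nthOut : ∀ {n} → Digraph n → ℕ → Fin n → Fin n → Bool
nthOut D k v u = walk D k v u ∧ not (walkBelow D k v u)

-- vertex-weighting with values in [0,∞) (here: nonnegative rationals)
Weighting : ℕ → Set
Weighting n = Fin n → ℚ

Nonneg : ∀ {n} → Weighting n → Set
Nonneg {n} η = (x : Fin n) → 0ℚ ≤ η x

weightN : ∀ {n} → Digraph n → Weighting n → ℕ → Fin n → ℚ
weightN D η k v = sumFin (λ u → if nthOut D k v u then η u else 0ℚ)

AltI : ∀ {n} → Digraph n → Set
AltI {n} D = Σ (Weighting n) λ η →
  Nonneg η × Σ (Fin n) (λ x → η x ≢ 0ℚ) ×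
  ((v : Fin n) → weightN D η 1 v ≤ weightN D η 2 v)

AltII : ∀ {n} → Digraph n → Set
AltII {n} D = Σ (Weighting n) λ η →
  Nonneg η ×
  ((v : Fin n) → weightN (reverse D) η 2 v < weightN (reverse D) η 1 v)

module Submission where

-- The theorem is an instance of Ville's theorem of the alternative, the strict form of
-- Farkas' lemma, proved here by Fourier–Motzkin elimination over ℚ.  Let M be the matrix
-- with M v u = [u ∈ N₂⁺(v)] − [u ∈ N₁⁺(v)].  Either some nonzero η ≥ 0 has (Mη) v ≥ 0 for
-- every v, which is (i), or some y ≥ 0 has (yᵀM) u < 0 for every u.  As u is an n-th
-- out-neighbour of v in D exactly when v is one of u in the reverse digraph,
-- (yᵀM) u = y(N₂⁺(u)) − y(N₁⁺(u)) computed in the reverse, so the second case is (ii).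
-- Both cannot hold, as yᵀMη would be both ≥ 0 and < 0.

open import Defs
open import Algebra.Bundles using (Ring; CommutativeSemiring)
import Algebra.Properties.Semiring.Sum
open import Data.Bool using (Bool; true; false; _∧_; _∨_; not; if_then_else_)
open import Data.Bool.Properties using (∧-comm; ∧-assoc; ∨-identityʳ; ∨-∧-commutativeSemiring)
open import Data.Empty using (⊥)
open import Data.Fin using (Fin; zero; suc; _≟_)
open import Data.List using (List; []; _∷_; _++_; map; concatMap; allFin)
open import Data.List.Membership.Propositional using (_∈_; find; lose)
open import Data.List.Membership.Propositional.Properties using (∈-allFin; ∈-map⁻)
open import Data.List.Relation.Unary.All as All using (All; []; _∷_)
import Data.List.Relation.Unary.All.Properties as All
open import Data.List.Relation.Unary.Any using (Any; here; there)
open import Data.Nat using (ℕ; zero; suc)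
open import Data.Product using (Σ; ∃-syntax; _×_; _,_; proj₁; proj₂)
open import Data.Rational
  using (ℚ; 0ℚ; 1ℚ; _+_; _*_; -_; _-_; _÷_; 1/_; _≤_; _<_; _⊔_; _⊓_; NonZero; ≢-nonZero;
         positive; negative; nonNegative)
open import Data.Rational.Properties hiding (_≟_)
open import Data.Rational.Solver using (module +-*-Solver)
open import Data.Sum as Sum using (_⊎_; inj₁; inj₂; [_,_]′)
open import Data.Unit using (⊤; tt)
open import Data.Vec.Functional as Vector using (Vector; head; tail)
open import Function using (_∘_)
open import Relation.Binary.Definitions using (Tri; tri<; tri≈; tri>)
open import Relation.Binary.PropositionalEquality
open import Relation.Nullary using (¬_; Dec; yes; no; contradiction)
open import Relation.Nullary.Decidable using (⌊_⌋)

open import Algebra.Properties.Ring +-*-ring using (x[y-z]≈xy-xz)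
open Algebra.Properties.Semiring.Sum (Ring.semiring +-*-ring)
  using (sum; sum-cong-≗; ∑-distrib-+; ∑-comm; *-distribˡ-sum)
module Disjunction = Algebra.Properties.Semiring.Sum (CommutativeSemiring.semiring ∨-∧-commutativeSemiring)

open +-*-Solver

p<q⇒p-q<0 : ∀ {p q} → p < q → p - q < 0ℚ
p<q⇒p-q<0 {p} {q} p<q = subst (p - q <_) (+-inverseʳ q) (+-monoˡ-< (- q) p<q)

p≤q⇒0≤q-p : ∀ {p q} → p ≤ q → 0ℚ ≤ q - p
p≤q⇒0≤q-p {p} {q} p≤q = subst (_≤ q - p) (+-inverseʳ p) (+-monoˡ-≤ (- p) p≤q)

p-q<0⇒p<q : ∀ {p q} → p - q < 0ℚ → p < q
p-q<0⇒p<q {p} {q} p-q<0 =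
  subst₂ _<_ (solve 2 (λ p q → (p :- q) :+ q := p) refl p q) (+-identityˡ q) (+-monoˡ-< q p-q<0)

0≤q-p⇒p≤q : ∀ {p q} → 0ℚ ≤ q - p → p ≤ q
0≤q-p⇒p≤q {p} {q} 0≤q-p =
  subst₂ _≤_ (+-identityˡ p) (solve 2 (λ p q → (q :- p) :+ p := q) refl p q) (+-monoˡ-≤ p 0≤q-p)

≤∧≢⇒< : ∀ {p q} → p ≤ q → p ≢ q → p < q
≤∧≢⇒< {p} {q} p≤q p≢q with <-cmp p q
... | tri< p<q _ _ = p<q
... | tri≈ _ p≡q _ = contradiction p≡q p≢q
... | tri> _ _ q<p = contradiction (≤-antisym p≤q (<⇒≤ q<p)) p≢q

*-nonneg : ∀ {p q} → 0ℚ ≤ p → 0ℚ ≤ q → 0ℚ ≤ p * q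
*-nonneg {p} {q} 0≤p 0≤q = nonNegative⁻¹ _ {{nonNeg*nonNeg⇒nonNeg p {{nonNegative 0≤p}} q {{nonNegative 0≤q}}}}

*-pos : ∀ {p q} → 0ℚ < p → 0ℚ < q → 0ℚ < p * q
*-pos {p} {q} 0<p 0<q = positive⁻¹ _ {{pos*pos⇒pos p {{positive 0<p}} q {{positive 0<q}}}}

sumFin≡sum : ∀ {n} (f : Fin n → ℚ) → sumFin f ≡ sum f
sumFin≡sum {zero} f = refl
sumFin≡sum {suc n} f = cong (f zero +_) (sumFin≡sum (tail f))

∑-neg : ∀ {n} (f : Fin n → ℚ) → sum (λ i → - f i) ≡ - sum f
∑-neg {zero} f = refl
∑-neg {suc n} f = trans (cong (- f zero +_) (∑-neg (tail f))) (sym (neg-distrib-+ (f zero) (sum (tail f))))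

∑-sub : ∀ {n} (f g : Fin n → ℚ) → sum (λ i → f i - g i) ≡ sum f - sum g
∑-sub f g = trans (∑-distrib-+ f (λ i → - g i)) (cong (sum f +_) (∑-neg g))

∑-nonneg : ∀ {n} {f : Fin n → ℚ} → (∀ i → 0ℚ ≤ f i) → 0ℚ ≤ sum f
∑-nonneg {zero} 0≤f = ≤-refl
∑-nonneg {suc n} 0≤f = +-mono-≤ (0≤f zero) (∑-nonneg (0≤f ∘ suc))

∑-pos : ∀ {n} {f : Fin n → ℚ} → (∀ i → 0ℚ ≤ f i) → ∀ j → 0ℚ < f j → 0ℚ < sum f
∑-pos {suc n} 0≤f zero 0<fj = +-mono-<-≤ 0<fj (∑-nonneg (0≤f ∘ suc))
∑-pos {suc n} 0≤f (suc j) 0<fj = +-mono-≤-< (0≤f zero) (∑-pos (0≤f ∘ suc) j 0<fj)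

ind : Bool → ℚ
ind b = if b then 1ℚ else 0ℚ

suc-≟ : ∀ {n} (i j : Fin n) → ⌊ suc i ≟ suc j ⌋ ≡ ⌊ i ≟ j ⌋
suc-≟ i j with i ≟ j
... | yes _ = refl
... | no _ = refl

∑-0* : ∀ {n} (f : Fin n → ℚ) → sum (λ i → 0ℚ * f i) ≡ 0ℚ
∑-0* f = trans (sym (*-distribˡ-sum 0ℚ f)) (*-zeroˡ (sum f))

∑-select : ∀ {n} (i : Fin n) (f : Fin n → ℚ) → sum (λ u → ind ⌊ i ≟ u ⌋ * f u) ≡ f i
∑-select zero f = trans (cong₂ _+_ (*-identityˡ (f zero)) (∑-0* (tail f))) (+-identityʳ (f zero))
∑-select (suc i) f = begin
  0ℚ * f zero + sum (λ u → ind ⌊ suc i ≟ suc u ⌋ * f (suc u))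
    ≡⟨ cong₂ _+_ (*-zeroˡ (f zero)) (sum-cong-≗ (λ u → cong (λ b → ind b * f (suc u)) (suc-≟ i u))) ⟩
  0ℚ + sum (λ u → ind ⌊ i ≟ u ⌋ * f (suc u))
    ≡⟨ +-identityˡ _ ⟩
  sum (λ u → ind ⌊ i ≟ u ⌋ * f (suc u))
    ≡⟨ ∑-select i (tail f) ⟩
  f (suc i) ∎
  where open ≡-Reasoning

ind-nonneg : ∀ b → 0ℚ ≤ ind b
ind-nonneg true = nonNegative⁻¹ 1ℚ
ind-nonneg false = ≤-refl

-- Finitely supported weightings

Weights : Set → Set
Weights I = List (ℚ × I)

weightedSum : ∀ {I : Set} → Weights I → (I → ℚ) → ℚ
weightedSum [] f = 0ℚ
weightedSum ((a , i) ∷ ws) f = a * f i + weightedSum ws f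

NonnegWeights : ∀ {I : Set} → Weights I → Set
NonnegWeights = All (λ w → 0ℚ ≤ proj₁ w)

SomePositiveWeight : ∀ {I : Set} → Weights I → Set
SomePositiveWeight = Any (λ w → 0ℚ < proj₁ w)

module _ {I : Set} {f : I → ℚ} (0≤f : ∀ i → 0ℚ ≤ f i) where

  weightedSum-nonneg : ∀ {ws} → NonnegWeights ws → 0ℚ ≤ weightedSum ws f
  weightedSum-nonneg [] = ≤-refl
  weightedSum-nonneg (0≤a ∷ 0≤ws) = +-mono-≤ (*-nonneg 0≤a (0≤f _)) (weightedSum-nonneg 0≤ws)

  weightedSum-pos : ∀ {ws} → NonnegWeights ws → Any (λ w → 0ℚ < proj₁ w × 0ℚ < f (proj₂ w)) ws →
                    0ℚ < weightedSum ws f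
  weightedSum-pos (_ ∷ 0≤ws) (here (0<a , 0<fi)) = +-mono-<-≤ (*-pos 0<a 0<fi) (weightedSum-nonneg 0≤ws)
  weightedSum-pos (0≤a ∷ 0≤ws) (there any) = +-mono-≤-< (*-nonneg 0≤a (0≤f _)) (weightedSum-pos 0≤ws any)

tally : ∀ {n} → Weights (Fin n) → Fin n → ℚ
tally ws u = weightedSum ws (λ i → ind ⌊ i ≟ u ⌋)

∑-tally : ∀ {n} (ws : Weights (Fin n)) (f : Fin n → ℚ) → sum (λ u → tally ws u * f u) ≡ weightedSum ws f
∑-tally [] f = ∑-0* f
∑-tally ((a , i) ∷ ws) f = begin
  sum (λ u → (a * ind ⌊ i ≟ u ⌋ + tally ws u) * f u)
    ≡⟨ sum-cong-≗ (λ u → solve 4 (λ a e t f → (a :* e :+ t) :* f := a :* (e :* f) :+ t :* f)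
                                 refl a (ind ⌊ i ≟ u ⌋) (tally ws u) (f u)) ⟩
  sum (λ u → a * (ind ⌊ i ≟ u ⌋ * f u) + tally ws u * f u)
    ≡⟨ ∑-distrib-+ (λ u → a * (ind ⌊ i ≟ u ⌋ * f u)) (λ u → tally ws u * f u) ⟩
  sum (λ u → a * (ind ⌊ i ≟ u ⌋ * f u)) + sum (λ u → tally ws u * f u)
    ≡⟨ cong₂ _+_ (sym (*-distribˡ-sum a (λ u → ind ⌊ i ≟ u ⌋ * f u))) (∑-tally ws f) ⟩
  a * sum (λ u → ind ⌊ i ≟ u ⌋ * f u) + weightedSum ws f
    ≡⟨ cong (λ s → a * s + weightedSum ws f) (∑-select i f) ⟩
  a * f i + weightedSum ws f ∎
  where open ≡-Reasoning

tally-nonneg : ∀ {n} {ws : Weights (Fin n)} → NonnegWeights ws → ∀ u → 0ℚ ≤ tally ws u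
tally-nonneg 0≤ws u = weightedSum-nonneg (λ i → ind-nonneg ⌊ i ≟ u ⌋) 0≤ws

tally-pos : ∀ {n} {ws : Weights (Fin n)} → NonnegWeights ws → SomePositiveWeight ws → ∃[ u ] 0ℚ < tally ws u
tally-pos 0≤ws pos with find pos
... | (_ , u) , w∈ws , 0<a = u , weightedSum-pos (λ i → ind-nonneg ⌊ i ≟ u ⌋) 0≤ws (lose w∈ws (0<a , 0<ind))
  where
  0<ind : 0ℚ < ind ⌊ u ≟ u ⌋
  0<ind with u ≟ u
  ... | yes _ = positive⁻¹ 1ℚ
  ... | no u≢u = contradiction refl u≢u

-- Strict bounds on one nonnegative unknown

data Bound : Set where
  lower upper : ℚ → Bound
  none : Bound

infix 4 _meets_

_meets_ : ℚ → Bound → Set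
y meets lower l = l < y
y meets upper u = y < u
y meets none = ⊤

⊔-< : ∀ {p q r} → p < r → q < r → p ⊔ q < r
⊔-< {p} {q} p<r q<r = [ (λ e → subst (_< _) (sym e) p<r) , (λ e → subst (_< _) (sym e) q<r) ]′ (⊔-sel p q)

<-⊓ : ∀ {p q r} → r < p → r < q → r < p ⊓ q
<-⊓ {p} {q} r<p r<q = [ (λ e → subst (_ <_) (sym e) r<p) , (λ e → subst (_ <_) (sym e) r<q) ]′ (⊓-sel p q)

lowerLimit : List Bound → ℚ
lowerLimit [] = 0ℚ
lowerLimit (lower l ∷ bs) = l ⊔ lowerLimit bs
lowerLimit (upper _ ∷ bs) = lowerLimit bs
lowerLimit (none ∷ bs) = lowerLimit bs

upperLimit : ℚ → List Bound → ℚ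
upperLimit t [] = t
upperLimit t (lower _ ∷ bs) = upperLimit t bs
upperLimit t (upper u ∷ bs) = u ⊓ upperLimit t bs
upperLimit t (none ∷ bs) = upperLimit t bs

0≤lowerLimit : ∀ bs → 0ℚ ≤ lowerLimit bs
0≤lowerLimit [] = ≤-refl
0≤lowerLimit (lower l ∷ bs) = p≤q⇒p≤r⊔q l (0≤lowerLimit bs)
0≤lowerLimit (upper _ ∷ bs) = 0≤lowerLimit bs
0≤lowerLimit (none ∷ bs) = 0≤lowerLimit bs

lower≤lowerLimit : ∀ {l bs} → lower l ∈ bs → l ≤ lowerLimit bs
lower≤lowerLimit {bs = lower l ∷ bs} (here refl) = p≤p⊔q l (lowerLimit bs)
lower≤lowerLimit {bs = lower l ∷ bs} (there l∈) = p≤q⇒p≤r⊔q l (lower≤lowerLimit l∈)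
lower≤lowerLimit {bs = upper _ ∷ bs} (there l∈) = lower≤lowerLimit l∈
lower≤lowerLimit {bs = none ∷ bs} (there l∈) = lower≤lowerLimit l∈

lowerLimit<upper : ∀ bs {u} → 0ℚ < u → (∀ {l} → lower l ∈ bs → l < u) → lowerLimit bs < u
lowerLimit<upper [] 0<u _ = 0<u
lowerLimit<upper (lower l ∷ bs) 0<u below = ⊔-< (below (here refl)) (lowerLimit<upper bs 0<u (below ∘ there))
lowerLimit<upper (upper _ ∷ bs) 0<u below = lowerLimit<upper bs 0<u (below ∘ there)
lowerLimit<upper (none ∷ bs) 0<u below = lowerLimit<upper bs 0<u (below ∘ there)

upperLimit≤upper : ∀ {u t bs} → upper u ∈ bs → upperLimit t bs ≤ u
upperLimit≤upper {t = t} {upper u ∷ bs} (here refl) = p⊓q≤p u (upperLimit t bs)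
upperLimit≤upper {bs = lower _ ∷ bs} (there u∈) = upperLimit≤upper u∈
upperLimit≤upper {bs = upper u ∷ bs} (there u∈) = p≤q⇒r⊓p≤q u (upperLimit≤upper u∈)
upperLimit≤upper {bs = none ∷ bs} (there u∈) = upperLimit≤upper u∈

<upperLimit : ∀ bs {x t} → x < t → (∀ {u} → upper u ∈ bs → x < u) → x < upperLimit t bs
<upperLimit [] x<t _ = x<t
<upperLimit (lower _ ∷ bs) x<t above = <upperLimit bs x<t (above ∘ there)
<upperLimit (upper u ∷ bs) x<t above = <-⊓ (above (here refl)) (<upperLimit bs x<t (above ∘ there))
<upperLimit (none ∷ bs) x<t above = <upperLimit bs x<t (above ∘ there)

bounds-satisfiable : ∀ bs → (∀ {u} → upper u ∈ bs → 0ℚ < u) →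
                     (∀ {l u} → lower l ∈ bs → upper u ∈ bs → l < u) →
                     ∃[ y ] 0ℚ ≤ y × All (y meets_) bs
bounds-satisfiable bs 0<upper lower<upper = solution (<-dense L<U)
  where
  L : ℚ
  L = lowerLimit bs
  -- L + 1 stands in for the minimum of an empty set of upper bounds.
  U : ℚ
  U = upperLimit (L + 1ℚ) bs
  L<U : L < U
  L<U = <upperLimit bs (subst (_< L + 1ℚ) (+-identityʳ L) (+-monoʳ-< L (positive⁻¹ 1ℚ)))
          (λ u∈ → lowerLimit<upper bs (0<upper u∈) (λ l∈ → lower<upper l∈ u∈))
  solution : (∃[ y ] L < y × y < U) → ∃[ y ] 0ℚ ≤ y × All (y meets_) bs
  solution (y , L<y , y<U) = y , ≤-trans (0≤lowerLimit bs) (<⇒≤ L<y) , All.tabulate meets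
    where
    meets : ∀ {b} → b ∈ bs → y meets b
    meets {lower l} l∈ = ≤-<-trans (lower≤lowerLimit l∈) L<y
    meets {upper u} u∈ = <-≤-trans y<U (upperLimit≤upper u∈)
    meets {none} _ = tt

p<-q⇒p+q<0 : ∀ {p q} → p < - q → p + q < 0ℚ
p<-q⇒p+q<0 {p} {q} p<-q = subst (p + q <_) (+-inverseˡ q) (+-monoˡ-< q p<-q)

p+q<0⇒p<-q : ∀ {p q} → p + q < 0ℚ → p < - q
p+q<0⇒p<-q {p} {q} p+q<0 =
  subst₂ _<_ (solve 2 (λ p q → (p :+ q) :- q := p) refl p q) (+-identityˡ (- q)) (+-monoˡ-< (- q) p+q<0)

root : (a b : ℚ) .{{_ : NonZero a}} → ℚ
root a b = - b ÷ a

module _ {a b : ℚ} .{{_ : NonZero a}} where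

  root*a : root a b * a ≡ - b
  root*a = begin
    - b * 1/ a * a   ≡⟨ *-assoc (- b) (1/ a) a ⟩
    - b * (1/ a * a) ≡⟨ cong (- b *_) (*-inverseˡ a) ⟩
    - b * 1ℚ         ≡⟨ *-identityʳ (- b) ⟩
    - b              ∎
    where open ≡-Reasoning

  root-scaled : ∀ c → root a b * (a * c) ≡ - (b * c)
  root-scaled c = begin
    root a b * (a * c) ≡⟨ sym (*-assoc (root a b) a c) ⟩
    root a b * a * c   ≡⟨ cong (_* c) root*a ⟩
    - b * c            ≡⟨ sym (neg-distribˡ-* b c) ⟩
    - (b * c)          ∎
    where open ≡-Reasoning

  below-root : ∀ {y} → 0ℚ < a → y < root a b → y * a + b < 0ℚ
  below-root 0<a y<r = p<-q⇒p+q<0 (subst (_ <_) root*a (*-monoˡ-<-pos a {{positive 0<a}} y<r))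

  above-root : ∀ {y} → a < 0ℚ → root a b < y → y * a + b < 0ℚ
  above-root a<0 r<y = p<-q⇒p+q<0 (subst (_ <_) root*a (*-monoˡ-<-neg a {{negative a<0}} r<y))

  root-pos : 0ℚ < a → b < 0ℚ → 0ℚ < root a b
  root-pos 0<a b<0 =
    *-cancelʳ-<-nonNeg a {{nonNegative (<⇒≤ 0<a)}} (subst₂ _<_ (sym (*-zeroˡ a)) (sym root*a) (neg-antimono-< b<0))

root<root : ∀ {a b a′ b′} .{{_ : NonZero a}} .{{_ : NonZero a′}} → 0ℚ < a → a′ < 0ℚ →
            a * b′ + (- a′) * b < 0ℚ → root a′ b′ < root a b
root<root {a} {b} {a′} {b′} 0<a a′<0 compatible =
  *-cancelʳ-<-nonNeg (a * - a′) {{nonNegative (*-nonneg (<⇒≤ 0<a) (<⇒≤ (neg-antimono-< a′<0)))}}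
    (subst₂ _<_ lhs rhs (p+q<0⇒p<-q compatible))
  where
  open ≡-Reasoning
  lhs : a * b′ ≡ root a′ b′ * (a * - a′)
  lhs = begin
    a * b′                    ≡⟨ solve 2 (λ a b′ → a :* b′ := :- (b′ :* (:- a))) refl a b′ ⟩
    - (b′ * - a)              ≡⟨ sym (root-scaled {a′} {b′} (- a)) ⟩
    root a′ b′ * (a′ * - a)   ≡⟨ cong (root a′ b′ *_) (a′*-a≡a*-a′) ⟩
    root a′ b′ * (a * - a′)   ∎
    where
    a′*-a≡a*-a′ : a′ * - a ≡ a * - a′
    a′*-a≡a*-a′ = solve 2 (λ a a′ → a′ :* (:- a) := a :* (:- a′)) refl a a′
  rhs : - ((- a′) * b) ≡ root a b * (a * - a′)
  rhs = begin
    - ((- a′) * b)  ≡⟨ cong -_ (*-comm (- a′) b) ⟩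
    - (b * - a′)    ≡⟨ sym (root-scaled {a} {b} (- a′)) ⟩
    root a b * (a * - a′) ∎

affineBound : ∀ a b → Tri (a < 0ℚ) (a ≡ 0ℚ) (0ℚ < a) → Bound
affineBound a b (tri< _ a≢0 _) = lower (root a b {{≢-nonZero a≢0}})
affineBound a b (tri≈ _ _ _) = none
affineBound a b (tri> _ a≢0 _) = upper (root a b {{≢-nonZero a≢0}})

affineBound-sound : ∀ {a b y} → (0ℚ ≤ a → b < 0ℚ) →
                    ∀ tri → y meets affineBound a b tri → y * a + b < 0ℚ
affineBound-sound _ (tri< a<0 a≢0 _) = above-root {{≢-nonZero a≢0}} a<0
affineBound-sound {b = b} {y} b<0 (tri≈ _ refl _) _ = subst (_< 0ℚ) (sym y*0+b≡b) (b<0 ≤-refl)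
  where
  y*0+b≡b : y * 0ℚ + b ≡ b
  y*0+b≡b = trans (cong (_+ b) (*-zeroʳ y)) (+-identityˡ b)
affineBound-sound _ (tri> _ a≢0 0<a) = below-root {{≢-nonZero a≢0}} 0<a

affineBound-upper-pos : ∀ {a b u} → (0ℚ ≤ a → b < 0ℚ) →
                        ∀ tri → upper u ≡ affineBound a b tri → 0ℚ < u
affineBound-upper-pos b<0 (tri> _ a≢0 0<a) refl = root-pos {{≢-nonZero a≢0}} 0<a (b<0 (<⇒≤ 0<a))

affineBound-lower<upper : ∀ {a b a′ b′ l u} triᵤ triₗ →
                          upper u ≡ affineBound a b triᵤ → lower l ≡ affineBound a′ b′ triₗ →
                          (0ℚ < a → a′ < 0ℚ → a * b′ + (- a′) * b < 0ℚ) → l < u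
affineBound-lower<upper (tri> _ a≢0 0<a) (tri< a′<0 a′≢0 _) refl refl compatible =
  root<root {{≢-nonZero a≢0}} {{≢-nonZero a′≢0}} 0<a a′<0 (compatible 0<a a′<0)

affine-system-solvable : ∀ {I : Set} (a b : I → ℚ) (is : List I) →
  (∀ {j} → j ∈ is → 0ℚ ≤ a j → b j < 0ℚ) →
  (∀ {i j} → i ∈ is → j ∈ is → 0ℚ < a i → a j < 0ℚ → a i * b j + (- a j) * b i < 0ℚ) →
  ∃[ y ] 0ℚ ≤ y × All (λ j → y * a j + b j < 0ℚ) is
affine-system-solvable {I} a b is b<0 compatible = solution (bounds-satisfiable (map bound is) 0<upper lower<upper)
  where
  tri : ∀ j → Tri (a j < 0ℚ) (a j ≡ 0ℚ) (0ℚ < a j)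
  tri j = <-cmp (a j) 0ℚ
  bound : I → Bound
  bound j = affineBound (a j) (b j) (tri j)
  0<upper : ∀ {u} → upper u ∈ map bound is → 0ℚ < u
  0<upper u∈ with ∈-map⁻ bound u∈
  ... | j , j∈is , u≡ = affineBound-upper-pos (b<0 j∈is) (tri j) u≡
  lower<upper : ∀ {l u} → lower l ∈ map bound is → upper u ∈ map bound is → l < u
  lower<upper l∈ u∈ with ∈-map⁻ bound l∈ | ∈-map⁻ bound u∈
  ... | j , j∈is , l≡ | i , i∈is , u≡ = affineBound-lower<upper (tri i) (tri j) u≡ l≡ (compatible i∈is j∈is)
  solution : (∃[ y ] 0ℚ ≤ y × All (y meets_) (map bound is)) →
             ∃[ y ] 0ℚ ≤ y × All (λ j → y * a j + b j < 0ℚ) is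
  solution (y , 0≤y , meets) =
    y , 0≤y , All.tabulate (λ j∈is → affineBound-sound (b<0 j∈is) (tri _) (All.lookup (All.map⁻ meets) j∈is))

-- Ville's theorem of the alternative

infix 7 _∙_

_∙_ : ∀ {m} → Vector ℚ m → Vector ℚ m → ℚ
y ∙ c = sum (λ k → y k * c k)

∙-combination : ∀ {m} (y : Vector ℚ m) a b (e f : Vector ℚ m) →
                y ∙ (λ k → a * e k + b * f k) ≡ a * (y ∙ e) + b * (y ∙ f)
∙-combination y a b e f = begin
  sum (λ k → y k * (a * e k + b * f k))
    ≡⟨ sum-cong-≗ (λ k → solve 5 (λ y a b e f → y :* (a :* e :+ b :* f) := a :* (y :* e) :+ b :* (y :* f))
                                 refl (y k) a b (e k) (f k)) ⟩
  sum (λ k → a * (y k * e k) + b * (y k * f k))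
    ≡⟨ ∑-distrib-+ (λ k → a * (y k * e k)) (λ k → b * (y k * f k)) ⟩
  sum (λ k → a * (y k * e k)) + sum (λ k → b * (y k * f k))
    ≡⟨ cong₂ _+_ (sym (*-distribˡ-sum a (λ k → y k * e k))) (sym (*-distribˡ-sum b (λ k → y k * f k))) ⟩
  a * (y ∙ e) + b * (y ∙ f) ∎
  where open ≡-Reasoning

SemipositiveCombination : ∀ {m} {I : Set} → (I → Vector ℚ m) → Set
SemipositiveCombination {m} {I} c =
  ∃[ ws ] NonnegWeights ws × SomePositiveWeight ws × (∀ k → 0ℚ ≤ weightedSum ws (λ i → c i k))

StrictSeparation : ∀ {m} {I : Set} → (I → Vector ℚ m) → List I → Set
StrictSeparation {m} c is = ∃[ y ] (∀ k → 0ℚ ≤ y k) × All (λ i → y ∙ c i < 0ℚ) is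

lookup-concatMap : ∀ {A B : Set} {P : B → Set} {f : A → List B} {xs x} →
                   All P (concatMap f xs) → x ∈ xs → All P (f x)
lookup-concatMap all = All.lookup (All.map⁻ (All.concat⁻ all))

module Elimination {m : ℕ} {I : Set} (c : I → Vector ℚ (suc m)) where

  t : I → ℚ
  t j = head (c j)

  d : I → Vector ℚ m
  d j = tail (c j)

  data Index : Set where
    keep : (j : I) → 0ℚ ≤ t j → Index
    pair : (i j : I) → 0ℚ < t i → t j < 0ℚ → Index

  -- The nonnegative combination t i * c j + (- t j) * c i has head zero.
  reduced : Index → Vector ℚ m
  reduced (keep j _) = d j
  reduced (pair i j _ _) k = t i * d j k + (- t j) * d i k

  keepIf : ∀ j → Dec (0ℚ ≤ t j) → List Index
  keepIf j (yes 0≤tj) = keep j 0≤tj ∷ []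
  keepIf j (no _) = []

  pairIf : ∀ i j → Dec (0ℚ < t i) → Dec (t j < 0ℚ) → List Index
  pairIf i j (yes 0<ti) (yes tj<0) = pair i j 0<ti tj<0 ∷ []
  pairIf i j (yes _) (no _) = []
  pairIf i j (no _) _ = []

  keptIndices : List I → List Index
  keptIndices is = concatMap (λ j → keepIf j (0ℚ ≤? t j)) is

  pairedIndices : List I → List Index
  pairedIndices is = concatMap (λ i → concatMap (λ j → pairIf i j (0ℚ <? t i) (t j <? 0ℚ)) is) is

  reducedIndices : List I → List Index
  reducedIndices is = keptIndices is ++ pairedIndices is

  lift : Weights Index → Weights I
  lift [] = []
  lift ((a , keep j _) ∷ ws) = (a , j) ∷ lift ws
  lift ((a , pair i j _ _) ∷ ws) = (a * t i , j) ∷ (a * - t j , i) ∷ lift ws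

  lift-nonneg : ∀ {ws} → NonnegWeights ws → NonnegWeights (lift ws)
  lift-nonneg {[]} [] = []
  lift-nonneg {(_ , keep _ _) ∷ _} (0≤a ∷ 0≤ws) = 0≤a ∷ lift-nonneg 0≤ws
  lift-nonneg {(_ , pair _ _ 0<ti tj<0) ∷ _} (0≤a ∷ 0≤ws) =
    *-nonneg 0≤a (<⇒≤ 0<ti) ∷ *-nonneg 0≤a (<⇒≤ (neg-antimono-< tj<0)) ∷ lift-nonneg 0≤ws

  lift-pos : ∀ {ws} → SomePositiveWeight ws → SomePositiveWeight (lift ws)
  lift-pos {(_ , keep _ _) ∷ _} (here 0<a) = here 0<a
  lift-pos {(_ , pair _ _ 0<ti _) ∷ _} (here 0<a) = here (*-pos 0<a 0<ti)
  lift-pos {(_ , keep _ _) ∷ _} (there pos) = there (lift-pos pos)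
  lift-pos {(_ , pair _ _ _ _) ∷ _} (there pos) = there (there (lift-pos pos))

  lift-head : ∀ {ws} → NonnegWeights ws → 0ℚ ≤ weightedSum (lift ws) t
  lift-head {[]} [] = ≤-refl
  lift-head {(a , keep j 0≤tj) ∷ _} (0≤a ∷ 0≤ws) = +-mono-≤ (*-nonneg 0≤a 0≤tj) (lift-head 0≤ws)
  lift-head {(a , pair i j _ _) ∷ ws} (_ ∷ 0≤ws) = subst (0ℚ ≤_) cancel (lift-head 0≤ws)
    where
    cancel : weightedSum (lift ws) t ≡ a * t i * t j + (a * - t j * t i + weightedSum (lift ws) t)
    cancel = solve 4 (λ a ti tj s → s := a :* ti :* tj :+ (a :* (:- tj) :* ti :+ s))
                     refl a (t i) (t j) (weightedSum (lift ws) t)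

  lift-tail : ∀ ws k → weightedSum (lift ws) (λ x → d x k) ≡ weightedSum ws (λ g → reduced g k)
  lift-tail [] k = refl
  lift-tail ((a , keep j _) ∷ ws) k = cong (a * d j k +_) (lift-tail ws k)
  lift-tail ((a , pair i j _ _) ∷ ws) k = begin
    a * t i * d j k + (a * - t j * d i k + weightedSum (lift ws) (λ x → d x k))
      ≡⟨ cong (λ s → a * t i * d j k + (a * - t j * d i k + s)) (lift-tail ws k) ⟩
    a * t i * d j k + (a * - t j * d i k + s)
      ≡⟨ solve 6 (λ a ti tj dj di s → a :* ti :* dj :+ (a :* (:- tj) :* di :+ s)
                                     := a :* (ti :* dj :+ (:- tj) :* di) :+ s)
               refl a (t i) (t j) (d j k) (d i k) s ⟩
    a * (t i * d j k + (- t j) * d i k) + s ∎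
    where
    open ≡-Reasoning
    s : ℚ
    s = weightedSum ws (λ g → reduced g k)

  liftCombination : SemipositiveCombination reduced → SemipositiveCombination c
  liftCombination (ws , 0≤ws , pos , 0≤comb) = lift ws , lift-nonneg 0≤ws , lift-pos pos , λ where
    zero → lift-head 0≤ws
    (suc k) → subst (0ℚ ≤_) (sym (lift-tail ws k)) (0≤comb k)

  module _ (y : Vector ℚ m) where

    keepIf-sound : ∀ {j} dec → All (λ g → y ∙ reduced g < 0ℚ) (keepIf j dec) → 0ℚ ≤ t j → y ∙ d j < 0ℚ
    keepIf-sound (yes _) (y∙dj<0 ∷ []) _ = y∙dj<0
    keepIf-sound (no 0≰tj) [] 0≤tj = contradiction 0≤tj 0≰tj

    pairIf-sound : ∀ {i j} deci decj → All (λ g → y ∙ reduced g < 0ℚ) (pairIf i j deci decj) →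
                   0ℚ < t i → t j < 0ℚ → t i * (y ∙ d j) + (- t j) * (y ∙ d i) < 0ℚ
    pairIf-sound {i} {j} (yes _) (yes _) (y∙r<0 ∷ []) _ _ =
      subst (_< 0ℚ) (∙-combination y (t i) (- t j) (d j) (d i)) y∙r<0
    pairIf-sound (yes _) (no tj≮0) [] _ tj<0 = contradiction tj<0 tj≮0
    pairIf-sound (no 0≮ti) _ [] 0<ti _ = contradiction 0<ti 0≮ti

  liftSeparation : ∀ is → StrictSeparation reduced (reducedIndices is) → StrictSeparation c is
  liftSeparation is (y , 0≤y , y∙r<0) = extend (affine-system-solvable t (λ j → y ∙ d j) is keeps-sound pairs-sound)
    where
    keeps-sound : ∀ {j} → j ∈ is → 0ℚ ≤ t j → y ∙ d j < 0ℚ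
    keeps-sound {j} j∈is = keepIf-sound y (0ℚ ≤? t j) (lookup-concatMap (All.++⁻ˡ (keptIndices is) y∙r<0) j∈is)
    pairs-sound : ∀ {i j} → i ∈ is → j ∈ is → 0ℚ < t i → t j < 0ℚ →
                  t i * (y ∙ d j) + (- t j) * (y ∙ d i) < 0ℚ
    pairs-sound {i} {j} i∈is j∈is = pairIf-sound y (0ℚ <? t i) (t j <? 0ℚ)
      (lookup-concatMap (lookup-concatMap (All.++⁻ʳ (keptIndices is) y∙r<0) i∈is) j∈is)
    extend : (∃[ y₀ ] 0ℚ ≤ y₀ × All (λ j → y₀ * t j + y ∙ d j < 0ℚ) is) → StrictSeparation c is
    extend (y₀ , 0≤y₀ , sat) = y₀ Vector.∷ y , (λ { zero → 0≤y₀ ; (suc k) → 0≤y k }) , sat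

ville : ∀ m {I : Set} (c : I → Vector ℚ m) (is : List I) → SemipositiveCombination c ⊎ StrictSeparation c is
ville zero c [] = inj₂ ((λ ()) , (λ ()) , [])
ville zero c (i ∷ _) = inj₁ ((1ℚ , i) ∷ [] , nonNegative⁻¹ 1ℚ ∷ [] , here (positive⁻¹ 1ℚ) , λ ())
ville (suc m) c is =
  Sum.map liftCombination (liftSeparation is) (ville m reduced (reducedIndices is))
  where open Elimination c

combination-excludes-separation : ∀ {n m} (c : Fin n → Vector ℚ m) {x : Fin n → ℚ} {y : Vector ℚ m} →
  (∀ u → 0ℚ ≤ x u) → (∃[ u ] 0ℚ < x u) → (∀ v → 0ℚ ≤ sum (λ u → x u * c u v)) →
  (∀ v → 0ℚ ≤ y v) → (∀ u → y ∙ c u < 0ℚ) → ⊥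
combination-excludes-separation c {x} {y} 0≤x (u₀ , 0<xu₀) 0≤xc 0≤y y∙c<0 = <-irrefl refl (≤-<-trans 0≤S S<0)
  where
  open ≡-Reasoning
  S : ℚ
  S = sum (λ u → x u * (y ∙ c u))
  0<-S : 0ℚ < - S
  0<-S = subst (0ℚ <_)
           (trans (sum-cong-≗ (λ u → sym (neg-distribʳ-* (x u) (y ∙ c u)))) (∑-neg (λ u → x u * (y ∙ c u))))
           (∑-pos (λ u → *-nonneg (0≤x u) (<⇒≤ (neg-antimono-< (y∙c<0 u)))) u₀
                  (*-pos 0<xu₀ (neg-antimono-< (y∙c<0 u₀))))
  S<0 : S < 0ℚ
  S<0 = subst₂ _<_ (solve 1 (λ S → :- (:- S) := S) refl S) refl (neg-antimono-< 0<-S)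
  S≡ : S ≡ sum (λ v → y v * sum (λ u → x u * c u v))
  S≡ = begin
    sum (λ u → x u * sum (λ v → y v * c u v))
      ≡⟨ sum-cong-≗ (λ u → *-distribˡ-sum (x u) (λ v → y v * c u v)) ⟩
    sum (λ u → sum (λ v → x u * (y v * c u v)))
      ≡⟨ ∑-comm (λ u v → x u * (y v * c u v)) ⟩
    sum (λ v → sum (λ u → x u * (y v * c u v)))
      ≡⟨ sum-cong-≗ (λ v → sum-cong-≗ (λ u → x*[y*c]≡y*[x*c] (x u) (y v) (c u v))) ⟩
    sum (λ v → sum (λ u → y v * (x u * c u v)))
      ≡⟨ sum-cong-≗ (λ v → sym (*-distribˡ-sum (y v) (λ u → x u * c u v))) ⟩
    sum (λ v → y v * sum (λ u → x u * c u v)) ∎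
    where
    x*[y*c]≡y*[x*c] : ∀ x y c → x * (y * c) ≡ y * (x * c)
    x*[y*c]≡y*[x*c] = solve 3 (λ x y c → x :* (y :* c) := y :* (x :* c)) refl
  0≤S : 0ℚ ≤ S
  0≤S = subst (0ℚ ≤_) (sym S≡) (∑-nonneg (λ v → *-nonneg (0≤y v) (0≤xc v)))

-- Walks in the reverse digraph

anyFin≡sum : ∀ {n} (f : Fin n → Bool) → anyFin f ≡ Disjunction.sum f
anyFin≡sum {zero} f = refl
anyFin≡sum {suc n} f = cong (f zero ∨_) (anyFin≡sum (tail f))

anyFin-cong : ∀ {n} {f g : Fin n → Bool} → (∀ w → f w ≡ g w) → anyFin f ≡ anyFin g
anyFin-cong {f = f} {g} f≗g = trans (anyFin≡sum f) (trans (Disjunction.sum-cong-≗ f≗g) (sym (anyFin≡sum g)))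

anyFin-∧ˡ : ∀ {n} b (f : Fin n → Bool) → b ∧ anyFin f ≡ anyFin (λ w → b ∧ f w)
anyFin-∧ˡ b f =
  trans (cong (b ∧_) (anyFin≡sum f)) (trans (Disjunction.*-distribˡ-sum b f) (sym (anyFin≡sum (λ w → b ∧ f w))))

anyFin-∧ʳ : ∀ {n} b (f : Fin n → Bool) → anyFin f ∧ b ≡ anyFin (λ w → f w ∧ b)
anyFin-∧ʳ b f =
  trans (cong (_∧ b) (anyFin≡sum f)) (trans (Disjunction.*-distribʳ-sum b f) (sym (anyFin≡sum (λ w → f w ∧ b))))

anyFin-comm : ∀ {m n} (g : Fin m → Fin n → Bool) →
              anyFin (λ w → anyFin (g w)) ≡ anyFin (λ z → anyFin (λ w → g w z))
anyFin-comm g = begin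
  anyFin (λ w → anyFin (g w))            ≡⟨ nested g ⟩
  Disjunction.sum (λ w → Disjunction.sum (g w))             ≡⟨ Disjunction.∑-comm g ⟩
  Disjunction.sum (λ z → Disjunction.sum (λ w → g w z))     ≡⟨ sym (nested (λ z w → g w z)) ⟩
  anyFin (λ z → anyFin (λ w → g w z))    ∎
  where
  open ≡-Reasoning
  nested : ∀ {m n} (h : Fin m → Fin n → Bool) →
           anyFin (λ w → anyFin (h w)) ≡ Disjunction.sum (λ w → Disjunction.sum (h w))
  nested h = trans (anyFin≡sum (λ w → anyFin (h w))) (Disjunction.sum-cong-≗ (λ w → anyFin≡sum (h w)))

anyFin-select : ∀ {n} (v : Fin n) (f : Fin n → Bool) → anyFin (λ w → ⌊ v ≟ w ⌋ ∧ f w) ≡ f v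
anyFin-select {suc n} zero f = begin
  f zero ∨ anyFin {n} (λ _ → false)
    ≡⟨ cong (f zero ∨_) (trans (anyFin≡sum {n} (λ _ → false)) (Disjunction.sum-replicate-zero n)) ⟩
  f zero ∨ false                    ≡⟨ ∨-identityʳ (f zero) ⟩
  f zero                            ∎
  where open ≡-Reasoning
anyFin-select (suc v) f = trans (anyFin-cong (λ w → cong (_∧ f (suc w)) (suc-≟ v w))) (anyFin-select v (tail f))

≟-sym : ∀ {n} (v w : Fin n) → ⌊ v ≟ w ⌋ ≡ ⌊ w ≟ v ⌋
≟-sym v w with v ≟ w | w ≟ v
... | yes _ | yes _ = refl
... | no _ | no _ = refl
... | yes v≡w | no w≢v = contradiction (sym v≡w) w≢v
... | no v≢w | yes w≡v = contradiction (sym w≡v) v≢w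

module _ {n : ℕ} (D : Digraph n) where

  walk-first : ∀ k v u → walk D (suc k) v u ≡ anyFin (λ w → D v w ∧ walk D k w u)
  walk-first zero v u = begin
    anyFin (λ w → ⌊ v ≟ w ⌋ ∧ D w u)   ≡⟨ anyFin-select v (λ w → D w u) ⟩
    D v u                               ≡⟨ sym (anyFin-select u (D v)) ⟩
    anyFin (λ w → ⌊ u ≟ w ⌋ ∧ D v w)
      ≡⟨ anyFin-cong (λ w → trans (∧-comm _ (D v w)) (cong (D v w ∧_) (≟-sym u w))) ⟩
    anyFin (λ w → D v w ∧ ⌊ w ≟ u ⌋)   ∎
    where open ≡-Reasoning
  walk-first (suc k) v u = begin
    anyFin (λ w → walk D (suc k) v w ∧ D w u)
      ≡⟨ anyFin-cong (λ w → cong (_∧ D w u) (walk-first k v w)) ⟩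
    anyFin (λ w → anyFin (λ z → D v z ∧ walk D k z w) ∧ D w u)
      ≡⟨ anyFin-cong (λ w → anyFin-∧ʳ (D w u) (λ z → D v z ∧ walk D k z w)) ⟩
    anyFin (λ w → anyFin (λ z → (D v z ∧ walk D k z w) ∧ D w u))
      ≡⟨ anyFin-comm (λ w z → (D v z ∧ walk D k z w) ∧ D w u) ⟩
    anyFin (λ z → anyFin (λ w → (D v z ∧ walk D k z w) ∧ D w u))
      ≡⟨ anyFin-cong (λ z → anyFin-cong (λ w → ∧-assoc (D v z) (walk D k z w) (D w u))) ⟩
    anyFin (λ z → anyFin (λ w → D v z ∧ (walk D k z w ∧ D w u)))
      ≡⟨ anyFin-cong (λ z → sym (anyFin-∧ˡ (D v z) (λ w → walk D k z w ∧ D w u))) ⟩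
    anyFin (λ z → D v z ∧ walk D (suc k) z u) ∎
    where open ≡-Reasoning

  walk-reverse : ∀ k u v → walk (reverse D) k u v ≡ walk D k v u
  walk-reverse zero u v = ≟-sym u v
  walk-reverse (suc k) u v = begin
    anyFin (λ w → walk (reverse D) k u w ∧ D v w) ≡⟨ anyFin-cong (λ w → cong (_∧ D v w) (walk-reverse k u w)) ⟩
    anyFin (λ w → walk D k w u ∧ D v w)           ≡⟨ anyFin-cong (λ w → ∧-comm (walk D k w u) (D v w)) ⟩
    anyFin (λ w → D v w ∧ walk D k w u)           ≡⟨ sym (walk-first k v u) ⟩
    walk D (suc k) v u ∎
    where open ≡-Reasoning

  walkBelow-reverse : ∀ k u v → walkBelow (reverse D) k u v ≡ walkBelow D k v u
  walkBelow-reverse zero u v = refl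
  walkBelow-reverse (suc k) u v = cong₂ _∨_ (walk-reverse k u v) (walkBelow-reverse k u v)

  nthOut-reverse : ∀ k u v → nthOut (reverse D) k u v ≡ nthOut D k v u
  nthOut-reverse k u v = cong₂ (λ a b → a ∧ not b) (walk-reverse k u v) (walkBelow-reverse k u v)

-- The expansion matrix of a digraph

*-ind : ∀ w b → w * ind b ≡ (if b then w else 0ℚ)
*-ind w true = *-identityʳ w
*-ind w false = *-zeroʳ w

∑-*-ind-sub : ∀ {n} (w : Fin n → ℚ) (p q : Fin n → Bool) → sum (λ u → w u * (ind (p u) - ind (q u))) ≡
              sumFin (λ u → if p u then w u else 0ℚ) - sumFin (λ u → if q u then w u else 0ℚ)
∑-*-ind-sub w p q = begin
  sum (λ u → w u * (ind (p u) - ind (q u)))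
    ≡⟨ sum-cong-≗ (λ u → x[y-z]≈xy-xz (w u) (ind (p u)) (ind (q u))) ⟩
  sum (λ u → w u * ind (p u) - w u * ind (q u))
    ≡⟨ ∑-sub (λ u → w u * ind (p u)) (λ u → w u * ind (q u)) ⟩
  sum (λ u → w u * ind (p u)) - sum (λ u → w u * ind (q u))
    ≡⟨ cong₂ _-_ (selected p) (selected q) ⟩
  sumFin (λ u → if p u then w u else 0ℚ) - sumFin (λ u → if q u then w u else 0ℚ) ∎
  where
  open ≡-Reasoning
  selected : ∀ r → sum (λ u → w u * ind (r u)) ≡ sumFin (λ u → if r u then w u else 0ℚ)
  selected r = trans (sum-cong-≗ (λ u → *-ind (w u) (r u))) (sym (sumFin≡sum (λ u → if r u then w u else 0ℚ)))

module _ {n : ℕ} (D : Digraph n) where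

  expansion : Fin n → Vector ℚ n
  expansion u v = ind (nthOut D 2 v u) - ind (nthOut D 1 v u)

  expansion-row : ∀ η v → sum (λ u → η u * expansion u v) ≡ weightN D η 2 v - weightN D η 1 v
  expansion-row η v = ∑-*-ind-sub η (nthOut D 2 v) (nthOut D 1 v)

  expansion-column : ∀ y u → y ∙ expansion u ≡ weightN (reverse D) y 2 u - weightN (reverse D) y 1 u
  expansion-column y u = trans
    (sum-cong-≗ (λ v → cong₂ (λ a b → y v * (ind a - ind b))
                             (sym (nthOut-reverse D 2 u v)) (sym (nthOut-reverse D 1 u v))))
    (∑-*-ind-sub y (nthOut (reverse D) 2 u) (nthOut (reverse D) 1 u))

  weaklyExpanding : SemipositiveCombination expansion → AltI D
  weaklyExpanding (ws , 0≤ws , pos , 0≤comb) =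
    tally ws , tally-nonneg 0≤ws , nonzero (tally-pos 0≤ws pos) , expanding
    where
    nonzero : (∃[ u ] 0ℚ < tally ws u) → Σ (Fin n) (λ u → tally ws u ≢ 0ℚ)
    nonzero (u , 0<ηu) = u , ≢-sym (<⇒≢ 0<ηu)
    expanding : ∀ v → weightN D (tally ws) 1 v ≤ weightN D (tally ws) 2 v
    expanding v = 0≤q-p⇒p≤q
      (subst (0ℚ ≤_) (trans (sym (∑-tally ws (λ u → expansion u v))) (expansion-row (tally ws) v)) (0≤comb v))

  stronglyContracting : StrictSeparation expansion (allFin n) → AltII D
  stronglyContracting (y , 0≤y , y∙c<0) =
    y , 0≤y , λ u → p-q<0⇒p<q (subst (_< 0ℚ) (expansion-column y u) (All.lookup y∙c<0 (∈-allFin u)))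

  exclusive : ¬ (AltI D × AltII D)
  exclusive ((η , 0≤η , (x , ηx≢0) , expanding) , (y , 0≤y , contracting)) =
    combination-excludes-separation expansion 0≤η (x , ≤∧≢⇒< (0≤η x) (≢-sym ηx≢0))
      (λ v → subst (0ℚ ≤_) (sym (expansion-row η v)) (p≤q⇒0≤q-p (expanding v))) 0≤y
      (λ u → subst (_< 0ℚ) (sym (expansion-column y u)) (p<q⇒p-q<0 (contracting u)))

theorem1 : (n : ℕ) (D : Digraph n) → Loopless D → NoTwoCycles D →
    (AltI D ⊎ AltII D) × ¬ (AltI D × AltII D)
theorem1 n D _ _ = Sum.map (weaklyExpanding D) (stronglyContracting D) (ville n (expansion D) (allFin n)) , exclusive D
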